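{- Let $\mathcal G$ be a class of graphs closed under taking induced subgraphs and let $\mathcal G_{\textsc{basic}}\subseteq\mathcal G$ be such that every $G\in\mathcal G$ either belongs to $\mathcal G_{\textsc{basic}}$ or has a clique cutset. Let $G\in\mathcal G$ with $G\notin\mathcal G_{\textsc{basic}}$, let $T$ be a clique cutset decomposition tree of $G$ of depth $p$ (so $p\geq1$), with the notation below, and let $w:V(G)\to\mathbb Z_{\geq 0}$ be a non-negative integer weight function, with $w(A)=\sum_{v\in A}w(v)$. Then one of the following holds: (1) for some $i\in\{0,1,\ldots,p-1\}$, $K_i$ is a clique cutset of $G$ for which there exists a split $(A,K_i,B)$ of $G$ such that $w(A)\geq 2$ and $w(B)\geq 2$; (2) for some $i\in\{0,1,\ldots,p\}$, every connected component $C$ of $G\setminus(K_i\cup B_i)$ satisfies $w(C)\leq 1$.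
   Context: A clique cutset of $G$ is a (possibly empty) clique $K$ such that $G\setminus K$ is disconnected; a split of it is a partition $(A,K,B)$ of $V(G)$ with $A,B$ nonempty and no edges between $A$ and $B$. A clique cutset decomposition tree of depth $p$ of $G$ consists of graphs $G_0=G,G_1,\ldots,G_p$ and $G_1^B,\ldots,G_p^B$ such that for each $i\in\{0,\ldots,p-1\}$, $G_i$ has a clique cutset with split $(A_i,K_i,B_i)$, $G_{i+1}=G[A_i\cup K_i]$ and $G_{i+1}^B=G[B_i\cup K_i]$; the graphs $G_1^B,\ldots,G_p^B,G_p$ have no clique cutset. One also sets $B_p=A_{p-1}$ and $K_p=K_{p-1}$. -}

module Defs where

open import Data.Nat using (ℕ; zero; suc; _+_; _≤_; _<_; _∸_)
open import Data.Bool using (Bool; true; false; if_then_else_)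
open import Data.Fin using (Fin)
import Data.Fin as F
open import Data.Vec using (Vec; []; _∷_)
open import Data.Fin.Subset using (Subset; _∈_; _∉_; _⊆_; _∪_; ⊤; ∁; Nonempty)
open import Data.Product using (Σ; ∃; ∃-syntax; _×_; _,_)
open import Data.Sum using (_⊎_)
open import Relation.Nullary using (¬_)
open import Relation.Binary.PropositionalEquality using (_≡_; _≢_)
open import Function.Definitions using (Injective)

record Graph : Set where
  field
    n      : ℕ
    adj    : Fin n → Fin n → Bool
    sym    : ∀ u v → adj u v ≡ adj v u
    irrefl : ∀ v → adj v v ≡ false
open Graph public

V : Graph → Set
V G = Fin (n G)

Edge : (G : Graph) → V G → V G → Set
Edge G u v = adj G u v ≡ true

_≤ind_ : Graph → Graph → Set
H ≤ind G = Σ (V H → V G) λ f → Injective _≡_ _≡_ f × (∀ u v → adj H u v ≡ adj G (f u) (f v))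

wsum : ∀ {m} → (Fin m → ℕ) → Subset m → ℕ
wsum {zero}  w []      = 0
wsum {suc m} w (b ∷ p) = (if b then w F.zero else 0) + wsum (λ i → w (F.suc i)) p

-- Everything below concerns induced subgraphs G[S] of a fixed graph G, S ⊆ V(G).

IsClique : (G : Graph) → Subset (n G) → Set
IsClique G K = ∀ u v → u ∈ K → v ∈ K → u ≢ v → Edge G u v

record Split (G : Graph) (S A K B : Subset (n G)) : Set where
  field
    cover   : ∀ v → v ∈ S → (v ∈ A ⊎ v ∈ K ⊎ v ∈ B)
    A⊆S     : A ⊆ S
    K⊆S     : K ⊆ S
    B⊆S     : B ⊆ S
    A∩K     : ∀ v → v ∈ A → v ∉ K
    A∩B     : ∀ v → v ∈ A → v ∉ B
    K∩B     : ∀ v → v ∈ K → v ∉ B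
    A≠∅     : Nonempty A
    B≠∅     : Nonempty B
    clique  : IsClique G K
    noEdge  : ∀ a b → a ∈ A → b ∈ B → ¬ Edge G a b

HasCliqueCutsetIn : (G : Graph) → Subset (n G) → Set
HasCliqueCutsetIn G S = ∃[ A ] ∃[ K ] ∃[ B ] Split G S A K B

HasCliqueCutset : Graph → Set
HasCliqueCutset G = HasCliqueCutsetIn G ⊤

-- Clique cutset decomposition tree of G of depth p, with all G_i, G_i^B
-- represented by their vertex sets (subsets of V(G)).
-- Gs i = V(G_i), and (As i, Ks i, Bs i) is the split used at G_i (i < p).
record CCDTree (G : Graph) (p : ℕ) : Set where
  field
    Gs Ks As Bs : ℕ → Subset (n G)
    G₀      : Gs 0 ≡ ⊤
    split   : ∀ i → i < p → Split G (Gs i) (As i) (Ks i) (Bs i)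
    next    : ∀ i → i < p → Gs (suc i) ≡ As i ∪ Ks i
    leafB   : ∀ i → i < p → ¬ HasCliqueCutsetIn G (Bs i ∪ Ks i)
    leafG   : ¬ HasCliqueCutsetIn G (Gs p)
    Kp      : Ks p ≡ Ks (p ∸ 1)
    Bp      : Bs p ≡ As (p ∸ 1)
open CCDTree public

data Reach (G : Graph) (S : Subset (n G)) : V G → V G → Set where
  here : ∀ {u} → u ∈ S → Reach G S u u
  step : ∀ {u w v} → u ∈ S → Edge G u w → Reach G S w v → Reach G S u v

IsComponent : (G : Graph) → Subset (n G) → Subset (n G) → Set
IsComponent G S C =
  Nonempty C × C ⊆ S × (∀ u v → u ∈ C → v ∈ C → Reach G C u v)
  × (∀ u v → u ∈ C → v ∈ S → Edge G u v → v ∈ C)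

-- Walk down the decomposition tree keeping the part V(G) ∖ V(Gᵢ) that has already been cut
-- away under control: each of its components has weight at most 1 and has a clique as its
-- neighbourhood in Gᵢ. At step i, a component C of G ∖ (Kᵢ ∪ Bᵢ) of weight at least 2 must
-- meet Aᵢ, and the clique condition then forbids C any neighbour in Bᵢ. Hence
-- (C , Kᵢ , V(G) ∖ (C ∪ Kᵢ)) is a split of G: either its second side also weighs at least 2,
-- giving (1), or the cut-away part of Gᵢ₊₁ still satisfies the invariant. If no step stops,
-- then at the leaf G ∖ (K_p ∪ B_p) is exactly the cut-away part, giving (2).
module Submission where

open import Defs
open import Data.Nat using (ℕ; zero; suc; _≤_; _<_; _≤?_; z≤n)
open import Data.Nat.Properties using (≤-refl; ≤-trans; ≤-reflexive; ≤-pred; <⇒≤; <⇒≱; ≰⇒>; +-monoʳ-≤; m≤n+m)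
open import Data.Bool using (true; false)
open import Data.Bool.Properties using (T-≡) renaming (_≟_ to _≟ᵇ_)
open import Data.Fin using (Fin) renaming (zero to fzero; suc to fsuc)
open import Data.Fin.Properties using (any?) renaming (_≟_ to _≟ᶠ_)
open import Data.Fin.Subset using (Subset; _∈_; _∉_; _⊆_; _⊃_; _∪_; _∩_; ∁; ⊤; ⊥; ⁅_⁆; Nonempty)
open import Data.Fin.Subset.Properties using (_∈?_; _⊂?_; ⊆-refl; ⊆-trans; drop-∷-⊆; ∈⊤; x∈⁅x⁆; x∈⁅y⁆⇒x≡y; x∈∁p⇒x∉p; x∉p⇒x∈∁p; p⊆p∪q; x∈p∪q⁺; x∈p∪q⁻; x∈p∩q⁺; x∈p∩q⁻; p∩q⊆q; ∪-comm)
open import Data.Fin.Subset.Induction using (Acc; acc; ⊃-wellFounded)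
open import Data.Vec using (_∷_; []; tabulate; here)
open import Data.Vec.Properties using (lookup∘tabulate; []=⇒lookup; lookup⇒[]=)
open import Data.Product using (∃-syntax; _×_; _,_; proj₁; proj₂)
open import Data.Sum using (_⊎_; inj₁; inj₂; [_,_]′)
import Data.Sum as Sum
open import Data.Empty using (⊥-elim)
open import Function using (_∘_; id; case_of_)
open import Function.Bundles using (Equivalence)
open import Relation.Nullary using (¬_; yes; no)
open import Relation.Nullary.Decidable using (_×-dec_; isYes; toWitness; fromWitness; decidable-stable)
open import Relation.Unary using (Pred; Decidable)
open import Relation.Binary.PropositionalEquality as ≡ using (_≡_; _≢_; refl; subst; cong₂; module ≡-Reasoning)

wsum-mono : ∀ {m} (w : Fin m → ℕ) {X Y : Subset m} → X ⊆ Y → wsum w X ≤ wsum w Y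
wsum-mono w {[]}        {[]}        _   = z≤n
wsum-mono w {true ∷ X}  {true ∷ Y}  X⊆Y = +-monoʳ-≤ (w fzero) (wsum-mono (w ∘ fsuc) (drop-∷-⊆ X⊆Y))
wsum-mono w {true ∷ X}  {false ∷ Y} X⊆Y = case X⊆Y here of λ ()
wsum-mono w {false ∷ X} {_ ∷ Y}     X⊆Y = ≤-trans (wsum-mono (w ∘ fsuc) (drop-∷-⊆ X⊆Y)) (m≤n+m _ _)

wsum-⊥ : ∀ {m} (w : Fin m → ℕ) → wsum w ⊥ ≡ 0
wsum-⊥ {zero}  w = refl
wsum-⊥ {suc m} w = wsum-⊥ (w ∘ fsuc)

≰2⇒≤1 : ∀ {x} → ¬ 2 ≤ x → x ≤ 1
≰2⇒≤1 2≰x = ≤-pred (≰⇒> 2≰x)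

module _ {m : ℕ} {p q : Subset m} {x : Fin m} where

  x∈∁p∪q⁺ : x ∉ p → x ∉ q → x ∈ ∁ (p ∪ q)
  x∈∁p∪q⁺ x∉p x∉q = x∉p⇒x∈∁p λ x∈p∪q → [ x∉p , x∉q ]′ (x∈p∪q⁻ p q x∈p∪q)

  x∈∁p∪q⁻ : x ∈ ∁ (p ∪ q) → x ∉ p × x ∉ q
  x∈∁p∪q⁻ x∈∁ = (λ x∈p → x∈∁p⇒x∉p x∈∁ (x∈p∪q⁺ (inj₁ x∈p)))
              , (λ x∈q → x∈∁p⇒x∉p x∈∁ (x∈p∪q⁺ (inj₂ x∈q)))

module _ {m ℓ} {P : Pred (Fin m) ℓ} (P? : Decidable P) where

  subset : Subset m
  subset = tabulate (isYes ∘ P?)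

  ∈-subset⁺ : ∀ {x} → P x → x ∈ subset
  ∈-subset⁺ {x} Px = lookup⇒[]= x subset
    (≡.trans (lookup∘tabulate (isYes ∘ P?) x) (Equivalence.to T-≡ (fromWitness Px)))

  ∈-subset⁻ : ∀ {x} → x ∈ subset → P x
  ∈-subset⁻ {x} x∈ = toWitness
    (Equivalence.from T-≡ (≡.trans (≡.sym (lookup∘tabulate (isYes ∘ P?) x)) ([]=⇒lookup x∈)))

module Saturation {m : ℕ} (f : Subset m → Subset m) (f-inflationary : ∀ X → X ⊆ f X) where

  saturateAcc : (X : Subset m) → Acc _⊃_ X → Subset m
  saturateAcc X (acc rec) with X ⊂? f X
  ... | yes X⊂fX = saturateAcc (f X) (rec X⊂fX)
  ... | no _     = X

  saturate : Subset m → Subset m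
  saturate X = saturateAcc X (⊃-wellFounded X)

  ⊆-saturate : ∀ X → X ⊆ saturate X
  ⊆-saturate X = go X (⊃-wellFounded X)
    where
    go : ∀ X a → X ⊆ saturateAcc X a
    go X (acc rec) with X ⊂? f X
    ... | yes X⊂fX = ⊆-trans (f-inflationary X) (go (f X) (rec X⊂fX))
    ... | no _     = ⊆-refl

  saturate-closed : ∀ X → f (saturate X) ⊆ saturate X
  saturate-closed X = go X (⊃-wellFounded X)
    where
    go : ∀ X a → f (saturateAcc X a) ⊆ saturateAcc X a
    go X (acc rec) with X ⊂? f X
    ... | yes X⊂fX = go (f X) (rec X⊂fX)
    ... | no X⊄fX  = λ x∈fX → decidable-stable (_ ∈? X)
                       λ x∉X → X⊄fX (f-inflationary X , _ , x∈fX , x∉X)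

  saturate-preserves : (P : Subset m → Set) → (∀ {X} → P X → P (f X)) → ∀ X → P X → P (saturate X)
  saturate-preserves P f-preserves X = go X (⊃-wellFounded X)
    where
    go : ∀ X a → P X → P (saturateAcc X a)
    go X (acc rec) PX with X ⊂? f X
    ... | yes X⊂fX = go (f X) (rec X⊂fX) (f-preserves PX)
    ... | no _     = PX

module Walks (G : Graph) where

  private variable
    S T X Y : Subset (n G)
    u v x y : V G

  edge-sym : Edge G u v → Edge G v u
  edge-sym {u} {v} e = ≡.trans (Graph.sym G v u) e

  reach-source : Reach G S u v → u ∈ S
  reach-source (here u∈S)     = u∈S
  reach-source (step u∈S _ _) = u∈S

  reach-target : Reach G S u v → v ∈ S
  reach-target (here v∈S)   = v∈S
  reach-target (step _ _ r) = reach-target r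

  reach-trans : Reach G S u v → Reach G S v x → Reach G S u x
  reach-trans (here _)       r′ = r′
  reach-trans (step u∈S e r) r′ = step u∈S e (reach-trans r r′)

  reach-sym : Reach G S u v → Reach G S v u
  reach-sym (here v∈S)     = here v∈S
  reach-sym (step u∈S e r) = reach-trans (reach-sym r) (step (reach-source r) (edge-sym e) (here u∈S))

  reach-mono : S ⊆ T → Reach G S u v → Reach G T u v
  reach-mono S⊆T (here v∈S)     = here (S⊆T v∈S)
  reach-mono S⊆T (step u∈S e r) = step (S⊆T u∈S) e (reach-mono S⊆T r)

  reach-into-closed : (∀ {x u} → x ∈ T → u ∈ S → Edge G u x → u ∈ T)
                    → Reach G S u v → v ∈ T → Reach G (S ∩ T) u v
  reach-into-closed closed (here v∈S) v∈T = here (x∈p∩q⁺ (v∈S , v∈T))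
  reach-into-closed closed (step u∈S e r) v∈T = step (x∈p∩q⁺ (u∈S , u∈T)) e r′
    where
    r′ = reach-into-closed closed r v∈T
    u∈T = closed (proj₂ (x∈p∩q⁻ _ _ (reach-source r′))) u∈S e

  Enters : Subset (n G) → Subset (n G) → V G → Set
  Enters X Y x = x ∈ Y ⊎ ∃[ d ] ∃[ y ] y ∈ Y × Edge G d y × Reach G X x d

  enters-step : u ∈ X → Edge G u v → Enters X Y v → Enters X Y u
  enters-step u∈X e (inj₁ v∈Y)                   = inj₂ (_ , _ , v∈Y , e , here u∈X)
  enters-step u∈X e (inj₂ (d , y , y∈Y , e′ , r)) = inj₂ (d , y , y∈Y , e′ , step u∈X e r)

  reach-stays-or-enters : (∀ {u} → u ∈ S → u ∈ X ⊎ u ∈ Y) → Reach G S u v → Reach G X u v ⊎ Enters X Y u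
  reach-stays-or-enters cases (here v∈S) = Sum.map here inj₁ (cases v∈S)
  reach-stays-or-enters cases (step u∈S e r) with cases u∈S
  ... | inj₁ u∈X = Sum.map (step u∈X e) (enters-step u∈X e) (reach-stays-or-enters cases r)
  ... | inj₂ u∈Y = inj₂ (inj₁ u∈Y)

  split-off : ∀ {C K} → IsClique G K → Nonempty C → (∀ {x} → x ∈ C → x ∉ K)
            → (∀ {x y} → x ∈ C → Edge G x y → y ∉ K → y ∈ C)
            → Nonempty (∁ (C ∪ K)) → Split G ⊤ C K (∁ (C ∪ K))
  split-off {C} {K} K-clique C≠∅ C∩K C-closed rest≠∅ = record
    { cover  = λ u _ → classify u
    ; A⊆S    = λ _ → ∈⊤
    ; K⊆S    = λ _ → ∈⊤
    ; B⊆S    = λ _ → ∈⊤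
    ; A∩K    = λ _ → C∩K
    ; A∩B    = λ _ u∈C u∈rest → proj₁ (x∈∁p∪q⁻ u∈rest) u∈C
    ; K∩B    = λ _ u∈K u∈rest → proj₂ (x∈∁p∪q⁻ u∈rest) u∈K
    ; A≠∅    = C≠∅
    ; B≠∅    = rest≠∅
    ; clique = K-clique
    ; noEdge = λ _ _ x∈C y∈rest e → proj₁ (x∈∁p∪q⁻ y∈rest) (C-closed x∈C e (proj₂ (x∈∁p∪q⁻ y∈rest)))
    }
    where
    classify : ∀ u → u ∈ C ⊎ u ∈ K ⊎ u ∈ ∁ (C ∪ K)
    classify u with u ∈? C | u ∈? K
    ... | yes u∈C | _       = inj₁ u∈C
    ... | no _    | yes u∈K = inj₂ (inj₁ u∈K)
    ... | no u∉C  | no u∉K  = inj₂ (inj₂ (x∈∁p∪q⁺ u∉C u∉K))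

module Components (G : Graph) where

  open Walks G

  private variable
    S C X : Subset (n G)
    u v x : V G

  neighboursIn : Subset (n G) → Subset (n G) → Subset (n G)
  neighboursIn S X = subset λ u → (u ∈? S) ×-dec any? λ x → (x ∈? X) ×-dec (adj G u x ≟ᵇ true)

  ∈-neighboursIn⁺ : u ∈ S → x ∈ X → Edge G u x → u ∈ neighboursIn S X
  ∈-neighboursIn⁺ u∈S x∈X e = ∈-subset⁺ _ (u∈S , _ , x∈X , e)

  ∈-neighboursIn⁻ : u ∈ neighboursIn S X → u ∈ S × ∃[ x ] x ∈ X × Edge G u x
  ∈-neighboursIn⁻ = ∈-subset⁻ _

  grow : Subset (n G) → Subset (n G) → Subset (n G)
  grow S X = X ∪ neighboursIn S X

  grow-inflationary : ∀ S X → X ⊆ grow S X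
  grow-inflationary S X = p⊆p∪q (neighboursIn S X)

  component : Subset (n G) → V G → Subset (n G)
  component S v = Saturation.saturate (grow S) (grow-inflationary S) (S ∩ ⁅ v ⁆)

  ∈-component : v ∈ S → v ∈ component S v
  ∈-component {v = v} {S = S} v∈S =
    Saturation.⊆-saturate (grow S) (grow-inflationary S) (S ∩ ⁅ v ⁆) (x∈p∩q⁺ (v∈S , x∈⁅x⁆ v))

  component-closed : x ∈ component S v → u ∈ S → Edge G u x → u ∈ component S v
  component-closed {S = S} {v = v} x∈C u∈S e =
    Saturation.saturate-closed (grow S) (grow-inflationary S) (S ∩ ⁅ v ⁆)
      (x∈p∪q⁺ (inj₂ (∈-neighboursIn⁺ u∈S x∈C e)))

  component-sound : u ∈ component S v → Reach G S u v
  component-sound {S = S} {v} =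
    Saturation.saturate-preserves (grow S) (grow-inflationary S) Sound grow-sound (S ∩ ⁅ v ⁆) base
    where
    Sound : Subset (n G) → Set
    Sound X = ∀ {u} → u ∈ X → Reach G S u v

    base : Sound (S ∩ ⁅ v ⁆)
    base u∈ with x∈p∩q⁻ S ⁅ v ⁆ u∈
    ... | u∈S , u∈⁅v⁆ with x∈⁅y⁆⇒x≡y v u∈⁅v⁆
    ...   | refl = here u∈S

    grow-sound : ∀ {X} → Sound X → Sound (grow S X)
    grow-sound {X} sound u∈ with x∈p∪q⁻ X _ u∈
    ... | inj₁ u∈X = sound u∈X
    ... | inj₂ u∈N with ∈-neighboursIn⁻ u∈N
    ...   | u∈S , _ , x∈X , e = step u∈S e (sound x∈X)

  component-complete : Reach G S u v → u ∈ component S v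
  component-complete (here v∈S)     = ∈-component v∈S
  component-complete (step u∈S e r) = component-closed (component-complete r) u∈S e

  component-connected : u ∈ component S v → Reach G (component S v) u v
  component-connected {u = u} {S = S} {v = v} u∈C =
    reach-mono (p∩q⊆q S (component S v))
      (reach-into-closed (component-closed {S = S} {v = v}) u⇝v (∈-component (reach-target u⇝v)))
    where
    u⇝v : Reach G S u v
    u⇝v = component-sound u∈C

  component-isComponent : v ∈ S → IsComponent G S (component S v)
  component-isComponent {v = v} {S = S} v∈S =
      (v , ∈-component v∈S)
    , (λ u∈C → reach-source (component-sound {S = S} {v = v} u∈C))
    , (λ u u′ u∈C u′∈C → reach-trans (component-connected {S = S} u∈C)
                                      (reach-sym (component-connected {S = S} u′∈C)))
    , (λ u u′ u∈C u′∈S e → component-closed {S = S} u∈C u′∈S (edge-sym e))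

  component-⊇ : IsComponent G S C → v ∈ C → C ⊆ component S v
  component-⊇ {v = v} (_ , C⊆S , C-connected , _) v∈C {u} u∈C =
    component-complete (reach-mono C⊆S (C-connected u v u∈C v∈C))

module CliqueCutsetStep (G : Graph) (w : V G → ℕ) where

  open Walks G
  open Components G

  private variable
    S Y : Subset (n G)
    u v x : V G

  LightComponents : Subset (n G) → Set
  LightComponents S = ∀ C → IsComponent G S C → wsum w C ≤ 1

  BalancedSplitAt : Subset (n G) → Set
  BalancedSplitAt K = ∃[ A ] ∃[ B ] Split G ⊤ A K B × 2 ≤ wsum w A × 2 ≤ wsum w B

  light-or-heavy-component : ∀ S → LightComponents S ⊎ ∃[ C ] IsComponent G S C × 2 ≤ wsum w C
  light-or-heavy-component S with any? (λ v → (v ∈? S) ×-dec (2 ≤? wsum w (component S v)))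
  ... | yes (v , v∈S , heavy) = inj₂ (component S v , component-isComponent v∈S , heavy)
  ... | no no-heavy = inj₁ λ where
    C C-comp@((v , v∈C) , C⊆S , _) →
      ≤-trans (wsum-mono w (component-⊇ C-comp v∈C))
              (≰2⇒≤1 λ heavy → no-heavy (v , C⊆S v∈C , heavy))

  -- For the part ∁ S already cut away: every component weighs at most 1 (stated for the
  -- subsets X of a component) and the neighbours in S of each component form a clique.
  record Invariant (S : Subset (n G)) : Set where
    field
      light              : ∀ {v} X → (∀ {u} → u ∈ X → Reach G (∁ S) u v) → wsum w X ≤ 1
      attachments-clique : ∀ {u v x y} → Reach G (∁ S) u v → x ∈ S → y ∈ S → x ≢ y
                         → Edge G u x → Edge G v y → Edge G x y

  invariant-⊤ : Invariant ⊤
  invariant-⊤ = record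
    { light = λ X walks → ≤-trans (wsum-mono w λ u∈X → ⊥-elim (outside (reach-source (walks u∈X))))
                                  (≤-trans (≤-reflexive (wsum-⊥ w)) z≤n)
    ; attachments-clique = λ r → ⊥-elim (outside (reach-source r))
    }
    where
    outside : ¬ u ∈ ∁ ⊤
    outside u∈∁⊤ = x∈∁p⇒x∉p u∈∁⊤ ∈⊤

  invariant⇒lightComponents : Invariant S → LightComponents (∁ S)
  invariant⇒lightComponents J C ((v , v∈C) , C⊆∁S , C-connected , _) =
    Invariant.light J C λ {u} u∈C → reach-mono C⊆∁S (C-connected u v u∈C v∈C)

  entering-neighbour : Invariant S → Y ⊆ S → Enters (∁ S) Y u → Edge G u x → x ∈ S
                     → x ∈ Y ⊎ ∃[ y ] y ∈ Y × Edge G x y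
  entering-neighbour J Y⊆S (inj₁ u∈Y) e x∈S = inj₂ (_ , u∈Y , edge-sym e)
  entering-neighbour {x = x} J Y⊆S (inj₂ (d , y , y∈Y , dy , r)) e x∈S with x ≟ᶠ y
  ... | yes refl = inj₁ y∈Y
  ... | no x≢y   = inj₂ (y , y∈Y , Invariant.attachments-clique J r x∈S (Y⊆S y∈Y) x≢y e dy)

  module _ {S A K B} (σ : Split G S A K B) (J : Invariant S) where

    open Split σ
    open Invariant J

    position : ∀ u → u ∈ ∁ S ⊎ u ∈ A ⊎ u ∈ K ⊎ u ∈ B
    position u with u ∈? S
    ... | yes u∈S = inj₂ (cover u u∈S)
    ... | no u∉S  = inj₁ (x∉p⇒x∈∁p u∉S)

    ∁S⊆∁K∪B : u ∈ ∁ S → u ∈ ∁ (K ∪ B)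
    ∁S⊆∁K∪B u∈∁S = x∈∁p∪q⁺ (x∈∁p⇒x∉p u∈∁S ∘ K⊆S) (x∈∁p⇒x∉p u∈∁S ∘ B⊆S)

    A⊆∁K∪B : u ∈ A → u ∈ ∁ (K ∪ B)
    A⊆∁K∪B u∈A = x∈∁p∪q⁺ (A∩K _ u∈A) (A∩B _ u∈A)

    ∁K∪B-cases : u ∈ ∁ (K ∪ B) → u ∈ ∁ S ⊎ u ∈ A
    ∁K∪B-cases {u} u∈ with position u
    ... | inj₁ u∈∁S               = inj₁ u∈∁S
    ... | inj₂ (inj₁ u∈A)         = inj₂ u∈A
    ... | inj₂ (inj₂ (inj₁ u∈K)) = ⊥-elim (proj₁ (x∈∁p∪q⁻ u∈) u∈K)
    ... | inj₂ (inj₂ (inj₂ u∈B)) = ⊥-elim (proj₂ (x∈∁p∪q⁻ u∈) u∈B)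

    ∁A∪K-cases : u ∈ ∁ (A ∪ K) → u ∈ ∁ S ⊎ u ∈ B
    ∁A∪K-cases {u} u∈ with position u
    ... | inj₁ u∈∁S               = inj₁ u∈∁S
    ... | inj₂ (inj₁ u∈A)         = ⊥-elim (proj₁ (x∈∁p∪q⁻ u∈) u∈A)
    ... | inj₂ (inj₂ (inj₁ u∈K)) = ⊥-elim (proj₂ (x∈∁p∪q⁻ u∈) u∈K)
    ... | inj₂ (inj₂ (inj₂ u∈B)) = inj₂ u∈B

    A-enterer-misses-B : Enters (∁ S) A u → Edge G u x → x ∉ B
    A-enterer-misses-B enters e x∈B with entering-neighbour J A⊆S enters e (B⊆S x∈B)
    ... | inj₁ x∈A             = A∩B _ x∈A x∈B
    ... | inj₂ (a , a∈A , xa) = noEdge a _ a∈A x∈B (edge-sym xa)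

    B-enterer-misses-A : Enters (∁ S) B u → Edge G u x → x ∉ A
    B-enterer-misses-A enters e x∈A with entering-neighbour J B⊆S enters e (A⊆S x∈A)
    ... | inj₁ x∈B             = A∩B _ x∈A x∈B
    ... | inj₂ (b , b∈B , xb) = noEdge _ b x∈A b∈B xb

    A∪K⊆S : x ∈ A ∪ K → x ∈ S
    A∪K⊆S x∈ = [ A⊆S , K⊆S ]′ (x∈p∪q⁻ A K x∈)

    B-enterer-neighbour-in-K : Enters (∁ S) B u → Edge G u x → x ∈ A ∪ K → x ∈ K
    B-enterer-neighbour-in-K enters e x∈ =
      [ (λ x∈A → ⊥-elim (B-enterer-misses-A enters e x∈A)) , id ]′ (x∈p∪q⁻ A K x∈)

    -- A walk outside A ∪ K either avoids B, and then the old invariant applies, or both its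
    -- ends reach B through ∁ S, and then their neighbours in A ∪ K all lie in the clique K.
    attachments-after : ∀ {u v x y} → Reach G (∁ (A ∪ K)) u v → x ∈ A ∪ K → y ∈ A ∪ K → x ≢ y
                      → Edge G u x → Edge G v y → Edge G x y
    attachments-after r x∈ y∈ x≢y ux vy
      with reach-stays-or-enters ∁A∪K-cases r | reach-stays-or-enters ∁A∪K-cases (reach-sym r)
    ... | inj₁ r′ | _       = attachments-clique r′ (A∪K⊆S x∈) (A∪K⊆S y∈) x≢y ux vy
    ... | inj₂ _  | inj₁ r′ = attachments-clique (reach-sym r′) (A∪K⊆S x∈) (A∪K⊆S y∈) x≢y ux vy
    ... | inj₂ u-enters | inj₂ v-enters =
      clique _ _ (B-enterer-neighbour-in-K u-enters ux x∈) (B-enterer-neighbour-in-K v-enters vy y∈) x≢y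

    module _ {C} (C-comp : IsComponent G (∁ (K ∪ B)) C) (heavy : 2 ≤ wsum w C) where

      C⊆∁K∪B : C ⊆ ∁ (K ∪ B)
      C⊆∁K∪B = proj₁ (proj₂ C-comp)

      C-connected : ∀ u v → u ∈ C → v ∈ C → Reach G C u v
      C-connected = proj₁ (proj₂ (proj₂ C-comp))

      C-closed-in-∁K∪B : ∀ u v → u ∈ C → v ∈ ∁ (K ∪ B) → Edge G u v → v ∈ C
      C-closed-in-∁K∪B = proj₂ (proj₂ (proj₂ C-comp))

      C-meets-A : ∃[ a ] a ∈ C × a ∈ A
      C-meets-A with any? (λ a → (a ∈? C) ×-dec (a ∈? A))
      ... | yes found = found
      ... | no none with proj₁ C-comp
      ...   | c , c∈C = ⊥-elim (<⇒≱ heavy (light C λ u∈C → reach-mono C⊆∁S (C-connected _ c u∈C c∈C)))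
        where
        C⊆∁S : C ⊆ ∁ S
        C⊆∁S {u} u∈C = [ id , (λ u∈A → ⊥-elim (none (u , u∈C , u∈A))) ]′ (∁K∪B-cases (C⊆∁K∪B u∈C))

      C-enters-A : u ∈ C → Enters (∁ S) A u
      C-enters-A u∈C with C-meets-A
      ... | a , a∈C , a∈A with reach-stays-or-enters ∁K∪B-cases (reach-mono C⊆∁K∪B (C-connected _ a u∈C a∈C))
      ...   | inj₁ r      = ⊥-elim (x∈∁p⇒x∉p (reach-target r) (A⊆S a∈A))
      ...   | inj₂ enters = enters

      C-closed : u ∈ C → Edge G u x → x ∉ K → x ∈ C
      C-closed {u} {x} u∈C e x∉K with position x
      ... | inj₁ x∈∁S               = C-closed-in-∁K∪B u x u∈C (∁S⊆∁K∪B x∈∁S) e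
      ... | inj₂ (inj₁ x∈A)         = C-closed-in-∁K∪B u x u∈C (A⊆∁K∪B x∈A) e
      ... | inj₂ (inj₂ (inj₁ x∈K)) = ⊥-elim (x∉K x∈K)
      ... | inj₂ (inj₂ (inj₂ x∈B)) = ⊥-elim (A-enterer-misses-B (C-enters-A u∈C) e x∈B)

      C-split : Split G ⊤ C K (∁ (C ∪ K))
      C-split with B≠∅
      ... | b , b∈B = split-off clique (proj₁ C-comp) (proj₁ ∘ x∈∁p∪q⁻ ∘ C⊆∁K∪B) C-closed (b , b∈rest)
        where
        b∈rest : b ∈ ∁ (C ∪ K)
        b∈rest = x∈∁p∪q⁺ (λ b∈C → proj₂ (x∈∁p∪q⁻ (C⊆∁K∪B b∈C)) b∈B) (λ b∈K → K∩B b b∈K b∈B)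

      light-after : ¬ 2 ≤ wsum w (∁ (C ∪ K))
                  → ∀ {v} X → (∀ {u} → u ∈ X → Reach G (∁ (A ∪ K)) u v) → wsum w X ≤ 1
      light-after rest-light X walks with any? (λ y → (y ∈? X) ×-dec (y ∈? C))
      ... | yes (y , y∈X , y∈C) =
        light X λ u∈X → reach-mono ∁A∪K∩C⊆∁S
          (reach-into-closed closed-in-∁A∪K (reach-trans (walks u∈X) (reach-sym (walks y∈X))) y∈C)
        where
        closed-in-∁A∪K : ∀ {x u} → x ∈ C → u ∈ ∁ (A ∪ K) → Edge G u x → u ∈ C
        closed-in-∁A∪K x∈C u∈ e = C-closed x∈C (edge-sym e) (proj₂ (x∈∁p∪q⁻ u∈))

        ∁A∪K∩C⊆∁S : ∁ (A ∪ K) ∩ C ⊆ ∁ S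
        ∁A∪K∩C⊆∁S z∈ with x∈p∩q⁻ (∁ (A ∪ K)) C z∈
        ... | z∈∁A∪K , z∈C =
          [ id , (λ z∈A → ⊥-elim (proj₁ (x∈∁p∪q⁻ z∈∁A∪K) z∈A)) ]′ (∁K∪B-cases (C⊆∁K∪B z∈C))
      ... | no none = ≤-trans (wsum-mono w X⊆rest) (≰2⇒≤1 rest-light)
        where
        X⊆rest : X ⊆ ∁ (C ∪ K)
        X⊆rest {u} u∈X =
          x∈∁p∪q⁺ (λ u∈C → none (u , u∈X , u∈C)) (proj₂ (x∈∁p∪q⁻ (reach-source (walks u∈X))))

    split-step : LightComponents (∁ (K ∪ B)) ⊎ BalancedSplitAt K ⊎ Invariant (A ∪ K)
    split-step with light-or-heavy-component (∁ (K ∪ B))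
    ... | inj₁ light-components = inj₁ light-components
    ... | inj₂ (C , C-comp , heavy) with 2 ≤? wsum w (∁ (C ∪ K))
    ...   | yes rest-heavy = inj₂ (inj₁ (C , ∁ (C ∪ K) , C-split C-comp heavy , heavy , rest-heavy))
    ...   | no rest-light  = inj₂ (inj₂ record
                               { light              = light-after C-comp heavy rest-light
                               ; attachments-clique = attachments-after
                               })

module DecompositionTree {G : Graph} (w : V G → ℕ) where

  open CliqueCutsetStep G w

  Outcome : ∀ {p} → CCDTree G p → Set
  Outcome {p} T = (∃[ i ] i < p × BalancedSplitAt (Ks T i))
                ⊎ (∃[ i ] i ≤ p × LightComponents (∁ (Ks T i ∪ Bs T i)))

  descend : ∀ {p} (T : CCDTree G p) k → k ≤ p → Outcome T ⊎ Invariant (Gs T k)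
  descend T zero _ = inj₂ (subst Invariant (≡.sym (G₀ T)) invariant-⊤)
  descend T (suc k) k<p with descend T k (<⇒≤ k<p)
  ... | inj₁ outcome = inj₁ outcome
  ... | inj₂ J with split-step (split T k k<p) J
  ...   | inj₁ light           = inj₁ (inj₂ (k , <⇒≤ k<p , light))
  ...   | inj₂ (inj₁ balanced) = inj₁ (inj₁ (k , k<p , balanced))
  ...   | inj₂ (inj₂ J-next)   = inj₂ (subst Invariant (≡.sym (next T k k<p)) J-next)

  Ks∪Bs≡Gs-at-leaf : ∀ {q} (T : CCDTree G (suc q)) → Ks T (suc q) ∪ Bs T (suc q) ≡ Gs T (suc q)
  Ks∪Bs≡Gs-at-leaf {q} T = begin
    Ks T (suc q) ∪ Bs T (suc q) ≡⟨ cong₂ _∪_ (Kp T) (Bp T) ⟩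
    Ks T q ∪ As T q             ≡⟨ ∪-comm (Ks T q) (As T q) ⟩
    As T q ∪ Ks T q             ≡⟨ ≡.sym (next T q ≤-refl) ⟩
    Gs T (suc q)                ∎
    where open ≡-Reasoning

  outcome : ∀ {q} (T : CCDTree G (suc q)) → Outcome T
  outcome {q} T with descend T (suc q) ≤-refl
  ... | inj₁ o = o
  ... | inj₂ J = inj₂ (suc q , ≤-refl ,
                   subst (LightComponents ∘ ∁) (≡.sym (Ks∪Bs≡Gs-at-leaf T)) (invariant⇒lightComponents J))

mainTheorem6 : (𝒢 𝒢basic : Graph → Set)
    → (∀ G H → H ≤ind G → 𝒢 G → 𝒢 H)
    → (∀ G → 𝒢basic G → 𝒢 G)
    → (∀ G → 𝒢 G → 𝒢basic G ⊎ HasCliqueCutset G)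
    → (G : Graph) → 𝒢 G → ¬ 𝒢basic G
    → (p : ℕ) (T : CCDTree G p) (w : V G → ℕ)
    → (∃[ i ] i < p × ∃[ A ] ∃[ B ] Split G ⊤ A (Ks T i) B
          × 2 ≤ wsum w A × 2 ≤ wsum w B)
      ⊎ (∃[ i ] i ≤ p × (∀ C → IsComponent G (∁ (Ks T i ∪ Bs T i)) C → wsum w C ≤ 1))
-- The hypotheses on the class are only needed to rule out depth 0.
mainTheorem6 _ _ _ _ basic-or-cutset G G∈𝒢 G∉basic zero T w =
  ⊥-elim ([ G∉basic , (λ cutset → leafG T (subst (HasCliqueCutsetIn G) (≡.sym (G₀ T)) cutset)) ]′
            (basic-or-cutset G G∈𝒢))
mainTheorem6 _ _ _ _ _ G _ _ (suc q) T w = DecompositionTree.outcome w T
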